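{- Let $x,y,v\in\{0,1\}^+$ be such that $|v|\geq 2$ and the first letter of $x$ differs from the first letter of $y$. Then there exists a word $w\in\{0,1\}^{|v|-1}$ such that $|wx|_v\not\equiv |wy|_v \pmod 2$.
   Context: For words $v,z$ with $v$ nonempty, $|z|_v$ denotes the number of (possibly overlapping) occurrences of $v$ as a block of consecutive letters in $z$; $|z|$ is the length of $z$; $wx$ denotes concatenation. -}

module Defs where

open import Data.Bool using (Bool; true; false; if_then_else_; _∧_)
open import Data.Bool.Properties using () renaming (_≟_ to _≟ᵇ_)
open import Data.List using (List; []; _∷_)
open import Data.Nat using (ℕ; zero; suc)
open import Relation.Nullary.Decidable using (⌊_⌋)

-- Binary words: lists over Bool (false = 0, true = 1).
Word : Set
Word = List Bool

isPrefix : Word → Word → Bool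
isPrefix [] z = true
isPrefix (a ∷ u) [] = false
isPrefix (a ∷ u) (b ∷ z) = ⌊ a ≟ᵇ b ⌋ ∧ isPrefix u z

-- occ v z = |z|_v : number of (possibly overlapping) occurrences of v
-- as a factor of z, i.e. the number of positions i such that v is a
-- prefix of the suffix of z starting at i.  (Intended for v nonempty.)
occ : Word → Word → ℕ
occ v [] = if isPrefix v [] then 1 else 0
occ v (b ∷ z) = (if isPrefix v (b ∷ z) then 1 else 0) Data.Nat.+ occ v z

module Submission where

-- Write v = v₁ t c, so that |t| = |v| − 2, and try w = d t.  An occurrence of v in
-- d t a x either starts at the first letter or lies inside t a x; the former exists
-- iff d = v₁ and c = a.  If the counts of v in t a x and t b y have different parity,
-- d = not v₁ works.  Otherwise d = v₁ adds an occurrence on exactly one side, as a ≠ b.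

open import Defs
open import Data.Bool using (Bool; true; false; not; if_then_else_)
open import Data.Bool.Properties using (¬-not; ∧-identityʳ) renaming (_≟_ to _≟ᵇ_)
open import Data.List using ([]; _∷_; [_]; length; _++_; _∷ʳ_; initLast; _∷ʳ′_)
open import Data.List.Properties using (length-++)
open import Data.Nat using (ℕ; zero; suc; _+_; _≤_; _∸_; _%_; s≤s)
open import Data.Nat.DivMod using ([m+n]%n≡m%n)
open import Data.Nat.Properties using (+-comm) renaming (_≟_ to _≟ℕ_)
open import Data.Product using (Σ; _×_; _,_)
open import Relation.Nullary using (yes; no)
open import Relation.Nullary.Decidable using (⌊_⌋)
open import Relation.Binary.PropositionalEquality using (_≡_; _≢_; refl; sym; trans; cong; subst₂)

indicator : Bool → ℕ
indicator b = if b then 1 else 0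

1+n%2≢n%2 : ∀ n → suc n % 2 ≢ n % 2
1+n%2≢n%2 zero    ()
1+n%2≢n%2 (suc n) eq = 1+n%2≢n%2 n (trans (sym eq) [2+n]%2≡n%2)
  where
  [2+n]%2≡n%2 : suc (suc n) % 2 ≡ n % 2
  [2+n]%2≡n%2 = trans (cong (_% 2) (+-comm 2 n)) ([m+n]%n≡m%n n 2)

indicator-+-%2-≢ : ∀ {p q} → p ≢ q → ∀ {m n} → m % 2 ≡ n % 2 →
                   (indicator p + m) % 2 ≢ (indicator q + n) % 2
indicator-+-%2-≢ {false} {false} p≢q _ = λ _ → p≢q refl
indicator-+-%2-≢ {true}  {true}  p≢q _ = λ _ → p≢q refl
indicator-+-%2-≢ {true}  {false} _ {m}     m≡n = λ eq → 1+n%2≢n%2 m (trans eq (sym m≡n))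
indicator-+-%2-≢ {false} {true}  _ {n = n} m≡n = λ eq → 1+n%2≢n%2 n (trans (sym eq) m≡n)

≟-distinguishes : ∀ c {a b} → a ≢ b → ⌊ c ≟ᵇ a ⌋ ≢ ⌊ c ≟ᵇ b ⌋
≟-distinguishes c {a} a≢b rewrite ¬-not (λ b≡a → a≢b (sym b≡a)) = lemma c a
  where
  lemma : ∀ c a → ⌊ c ≟ᵇ a ⌋ ≢ ⌊ c ≟ᵇ not a ⌋
  lemma false false ()
  lemma false true  ()
  lemma true  false ()
  lemma true  true  ()

isPrefix-refl-head : ∀ a u z → isPrefix (a ∷ u) (a ∷ z) ≡ isPrefix u z
isPrefix-refl-head false u z = refl
isPrefix-refl-head true  u z = refl

isPrefix-++ˡ : ∀ t u z → isPrefix (t ++ u) (t ++ z) ≡ isPrefix u z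
isPrefix-++ˡ []      u z = refl
isPrefix-++ˡ (a ∷ t) u z = trans (isPrefix-refl-head a (t ++ u) (t ++ z)) (isPrefix-++ˡ t u z)

isPrefix-singleton : ∀ c a z → isPrefix [ c ] (a ∷ z) ≡ ⌊ c ≟ᵇ a ⌋
isPrefix-singleton c a z = ∧-identityʳ ⌊ c ≟ᵇ a ⌋

occ-not-head : ∀ a u z → occ (a ∷ u) (not a ∷ z) ≡ occ (a ∷ u) z
occ-not-head false u z = refl
occ-not-head true  u z = refl

occ-matching-head : ∀ a t c b z →
  occ (a ∷ t ∷ʳ c) (a ∷ t ++ b ∷ z) ≡ indicator ⌊ c ≟ᵇ b ⌋ + occ (a ∷ t ∷ʳ c) (t ++ b ∷ z)
occ-matching-head a t c b z =
  cong (λ p → indicator p + occ (a ∷ t ∷ʳ c) (t ++ b ∷ z))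
       (trans (isPrefix-refl-head a (t ∷ʳ c) (t ++ b ∷ z))
              (trans (isPrefix-++ˡ t [ c ] (b ∷ z)) (isPrefix-singleton c b z)))

length-∷ʳ : ∀ (t : Word) c → length (t ∷ʳ c) ≡ suc (length t)
length-∷ʳ t c = trans (length-++ t) (+-comm (length t) 1)

lemma5p1 : (a b : Bool) (x y v : Word) →
    a ≢ b → 2 ≤ length v →
    Σ Word (λ w → (length w ≡ length v ∸ 1) ×
    (occ v (w ++ (a ∷ x)) % 2 ≢ occ v (w ++ (b ∷ y)) % 2))
lemma5p1 a b x y (v₁ ∷ u) a≢b (s≤s _) with initLast u
... | t ∷ʳ′ c with occ v (t ++ a ∷ x) % 2 ≟ℕ occ v (t ++ b ∷ y) % 2
  where v = v₁ ∷ t ∷ʳ c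
... | no parities-differ = not v₁ ∷ t , sym (length-∷ʳ t c) ,
  subst₂ (λ m n → m % 2 ≢ n % 2)
         (sym (occ-not-head v₁ (t ∷ʳ c) (t ++ a ∷ x)))
         (sym (occ-not-head v₁ (t ∷ʳ c) (t ++ b ∷ y)))
         parities-differ
... | yes parities-agree = v₁ ∷ t , sym (length-∷ʳ t c) ,
  subst₂ (λ m n → m % 2 ≢ n % 2)
         (sym (occ-matching-head v₁ t c a x))
         (sym (occ-matching-head v₁ t c b y))
         (indicator-+-%2-≢ (≟-distinguishes c a≢b) parities-agree)
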